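{- Let $\mathcal U$ be a set of $n\ge1$ items and let $\pi_1,\dots,\pi_k$ ($k\ge1$) be bijections $\mathcal U\to[n]$. Then there exists a sequence $(x_1,\dots,x_s)$ of distinct elements of $\mathcal U$ that is semitone with respect to each $\pi_i$ and has length $s>\frac{\log_2 n}{k+1}$.
   Context: Semitone sequences are defined recursively: the empty sequence is semitone with respect to any permutation $\pi$, and a sequence $(x_1,\dots,x_s)$ is semitone with respect to $\pi$ if $\pi(x_s)\in\{\min_{i\in[s]}\pi(x_i),\max_{i\in[s]}\pi(x_i)\}$ and $(x_1,\dots,x_{s-1})$ is semitone with respect to $\pi$. -}

module Defs where

open import Data.Nat using (ℕ)
open import Data.Fin using (Fin; _≤_)
open import Data.List using (List; []; _∷ʳ_)
open import Data.List.Relation.Unary.All using (All)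
open import Data.Sum using (_⊎_)
open import Function.Bundles using (_⤖_; Bijection)

-- Semitone sequences, following the paper's recursive definition:
-- the empty sequence is semitone; (x₁,…,xₛ) is semitone iff
-- π(xₛ) is the min or the max of {π(x₁),…,π(xₛ)} and (x₁,…,xₛ₋₁) is semitone.
-- (Comparing π(xₛ) against the prefix suffices, since π(xₛ) ≤ π(xₛ) trivially.)
data Semitone {U : Set} {n : ℕ} (π : U → Fin n) : List U → Set where
  [] : Semitone π []
  snoc : ∀ (xs : List U) (x : U) →
         Semitone π xs →
         (All (λ y → π x ≤ π y) xs ⊎ All (λ y → π y ≤ π x) xs) →
         Semitone π (xs ∷ʳ x)

SemitoneWrt : {U : Set} {n : ℕ} → U ⤖ Fin n → List U → Set
SemitoneWrt π = Semitone (Bijection.to π)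

module Submission where

-- Given a list S = T ∷ʳ x of items, take its
-- last element x as the pivot.  For one ordering f, the items of T split
-- into those below x and those above x; the larger part keeps at least half
-- of T, and x is extremal (minimum or maximum) over it.  Doing this once for
-- each of the k orderings leaves a sublist S′ of T with |T| ≤ 2ᵏ·|S′| over
-- which x is extremal in every ordering.  Recursively pick a common semitone
-- sequence xs inside S′ and append x: since x is extremal over all of S′ ⊇ xs,
-- the sequence xs ∷ʳ x is again semitone.  Each step costs a factor of at
-- most 2ᵏ⁺¹ in length, giving |S| < 2^(|xs|·(k+1)).

open import Defs
open import Data.Nat using (ℕ; suc; _≤_; _<_; _*_; _^_)
open import Data.Fin using (Fin)
open import Data.List using (List; length)
open import Data.List.Relation.Unary.Unique.Propositional using (Unique)
open import Data.Product using (∃; _×_)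
open import Function.Bundles using (_⤖_)

open import Data.Nat using (zero; _+_; z≤n; s≤s; _≤?_)
open import Data.Nat.Properties
open import Data.Nat.Induction using (<-wellFounded)
import Data.Fin as Fin
open import Data.List using ([]; _∷_; _∷ʳ_; filter; map; allFin; initLast; _∷ʳ′_)
open import Data.List.Properties using (length-++; length-map; length-tabulate)
open import Data.List.Relation.Unary.All using (All)
open import Data.List.Relation.Unary.All.Properties using (all-filter)
import Data.List.Relation.Unary.All as All
open import Data.List.Relation.Unary.AllPairs using ([]; _∷_)
import Data.List.Relation.Unary.Unique.Propositional.Properties as Unique
open import Data.List.Relation.Binary.Sublist.Propositional as Sublist
  using (_⊆_; []; _∷_; ⊆-refl; ⊆-trans)
open import Data.List.Relation.Binary.Sublist.Propositional.Properties
  using (All-resp-⊆; filter-⊆; ++⁺; length-mono-≤)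
open import Data.Product using (_,_)
open import Data.Sum using (_⊎_; inj₁; inj₂)
import Data.Sum as Sum
open import Data.Bool using (true; false)
open import Function.Base using (_∘_)
open import Function.Bundles using (Bijection)
open import Function.Construct.Symmetry using (⤖-sym)
open import Induction.WellFounded using (Acc; acc)
open import Relation.Binary.PropositionalEquality
open import Relation.Nullary using (does; yes; no)
open import Relation.Unary using (Pred; Decidable; ∁)
open import Relation.Unary.Properties using (∁?)

sum≤double : ∀ {a b c} → a ≤ c → b ≤ c → a + b ≤ 2 * c
sum≤double {c = c} a≤c b≤c =
  ≤-trans (+-mono-≤ a≤c b≤c) (≤-reflexive (cong (c +_) (sym (+-identityʳ c))))

doubling : ∀ {t m s} q → t ≤ q * m → m ≤ 2 * s → t ≤ (2 * q) * s
doubling {t} {m} {s} q t≤qm m≤2s = ≤-trans t≤qm (begin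
  q * m        ≤⟨ *-monoʳ-≤ q m≤2s ⟩
  q * (2 * s)  ≡⟨ sym (*-assoc q 2 s) ⟩
  (q * 2) * s  ≡⟨ cong (_* s) (*-comm q 2) ⟩
  (2 * q) * s  ∎)
  where open ≤-Reasoning

stepBound : ∀ {t m} k s → t ≤ 2 ^ k * m → m < 2 ^ (s * suc k) →
            suc t < 2 ^ (suc s * suc k)
stepBound {t} {m} k s t≤qm m<p = begin-strict
  suc t              ≤⟨ s≤s t≤qm ⟩
  1 + q * m          ≤⟨ +-monoˡ-≤ (q * m) (m^n>0 2 k) ⟩
  q + q * m          ≡⟨ sym (*-suc q m) ⟩
  q * suc m          ≤⟨ *-monoʳ-≤ q m<p ⟩
  q * p              <⟨ m<m+n (q * p) (≤-trans qp>0 (m≤m+n (q * p) 0)) ⟩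
  2 * (q * p)        ≡⟨ sym (*-assoc 2 q p) ⟩
  2 ^ suc k * p      ≡⟨ sym (^-distribˡ-+-* 2 (suc k) (s * suc k)) ⟩
  2 ^ (suc s * suc k) ∎
  where
    open ≤-Reasoning
    q = 2 ^ k
    p = 2 ^ (s * suc k)
    qp>0 : 0 < q * p
    qp>0 = *-mono-≤ (m^n>0 2 k) (m^n>0 2 (s * suc k))

module _ {A : Set} where

  unique-⊆ : ∀ {xs ys : List A} → xs ⊆ ys → Unique ys → Unique xs
  unique-⊆ []                 []          = []
  unique-⊆ (_ Sublist.∷ʳ xs⊆ys) (_ ∷ u)   = unique-⊆ xs⊆ys u
  unique-⊆ (refl ∷ xs⊆ys)     (y∉ys ∷ u)  = All-resp-⊆ xs⊆ys y∉ys ∷ unique-⊆ xs⊆ys u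

  length-filter-∁ : ∀ {p} {P : Pred A p} (P? : Decidable P) xs →
                    length (filter P? xs) + length (filter (∁? P?) xs) ≡ length xs
  length-filter-∁ P? []       = refl
  length-filter-∁ P? (x ∷ xs) with does (P? x)
  ... | true  = cong suc (length-filter-∁ P? xs)
  ... | false = trans (+-suc _ _) (cong suc (length-filter-∁ P? xs))

  halve : ∀ {p} {P : Pred A p} (P? : Decidable P) (T : List A) →
          ∃ λ S → S ⊆ T × (All P S ⊎ All (∁ P) S) × length T ≤ 2 * length S
  halve P? T with length (filter (∁? P?) T) ≤? length (filter P? T)
  ... | yes out≤in = filter P? T , filter-⊆ P? T , inj₁ (all-filter P? T) ,
                     ≤-trans partition (sum≤double ≤-refl out≤in)
    where partition = ≤-reflexive (sym (length-filter-∁ P? T))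
  ... | no  out≰in = filter (∁? P?) T , filter-⊆ (∁? P?) T , inj₂ (all-filter (∁? P?) T) ,
                     ≤-trans partition (sum≤double (≰⇒≥ out≰in) ≤-refl)
    where partition = ≤-reflexive (sym (length-filter-∁ P? T))

module _ {U : Set} {n : ℕ} where

  -- x is extremal over ys for f when f x is a lower or an upper bound of
  -- f on ys; this is exactly the condition for appending x to a semitone ys.
  Extremal : (U → Fin n) → U → List U → Set
  Extremal f x ys = All (λ y → f x Fin.≤ f y) ys ⊎ All (λ y → f y Fin.≤ f x) ys

  extremal-⊆ : ∀ {f x} {xs ys : List U} → xs ⊆ ys → Extremal f x ys → Extremal f x xs
  extremal-⊆ xs⊆ys = Sum.map (All-resp-⊆ xs⊆ys) (All-resp-⊆ xs⊆ys)

  extremalHalf : (f : U → Fin n) (x : U) (T : List U) →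
                 ∃ λ S → S ⊆ T × Extremal f x S × length T ≤ 2 * length S
  extremalHalf f x T with halve (λ y → f y Fin.≤? f x) T
  ... | S , S⊆T , inj₁ below , len = S , S⊆T , inj₂ below , len
  ... | S , S⊆T , inj₂ above , len = S , S⊆T , inj₁ (All.map ≰⇒≥ above) , len

  extremalPart : ∀ {k} (ρ : Fin k → U → Fin n) (x : U) (T : List U) →
                 ∃ λ S → S ⊆ T × (∀ i → Extremal (ρ i) x S) × length T ≤ 2 ^ k * length S
  extremalPart {zero}  ρ x T = T , ⊆-refl , (λ ()) , ≤-reflexive (sym (+-identityʳ _))
  extremalPart {suc k} ρ x T with extremalPart (ρ ∘ Fin.suc) x T
  ... | S₁ , S₁⊆T , extremal₁ , len₁ with extremalHalf (ρ Fin.zero) x S₁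
  ... | S , S⊆S₁ , extremal₀ , len₀ =
    S , ⊆-trans S⊆S₁ S₁⊆T , extremal , doubling (2 ^ k) len₁ len₀
    where
      extremal : ∀ i → Extremal (ρ i) x S
      extremal Fin.zero    = extremal₀
      extremal (Fin.suc i) = extremal-⊆ S⊆S₁ (extremal₁ i)

  record SemitoneSubsequence {k} (ρ : Fin k → U → Fin n) (S : List U) : Set where
    field
      xs       : List U
      xs⊆S     : xs ⊆ S
      semitone : ∀ i → Semitone (ρ i) xs
      long     : length S < 2 ^ (length xs * suc k)

  length-∷ʳ : ∀ (xs : List U) x → length (xs ∷ʳ x) ≡ suc (length xs)
  length-∷ʳ xs x = trans (length-++ xs) (+-comm (length xs) 1)

  semitoneSubsequence : ∀ {k} (ρ : Fin k → U → Fin n) (S : List U) →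
                        Acc _<_ (length S) → SemitoneSubsequence ρ S
  semitoneSubsequence ρ S _ with initLast S
  semitoneSubsequence ρ .[] _ | [] =
    record { xs = [] ; xs⊆S = [] ; semitone = λ _ → [] ; long = s≤s z≤n }
  semitoneSubsequence {k} ρ .(T ∷ʳ x) (acc smaller) | T ∷ʳ′ x with extremalPart ρ x T
  ... | S′ , S′⊆T , extremal , lenT = record
    { xs       = xs ∷ʳ x
    ; xs⊆S     = ++⁺ (⊆-trans xs⊆S′ S′⊆T) ⊆-refl
    ; semitone = λ i → snoc xs x (semitone i) (extremal-⊆ xs⊆S′ (extremal i))
    ; long     = subst₂ (λ a b → a < 2 ^ (b * suc k))
                   (sym (length-∷ʳ T x)) (sym (length-∷ʳ xs x))
                   (stepBound k (length xs) lenT long)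
    }
    where
      S′<S : length S′ < length (T ∷ʳ x)
      S′<S = subst (length S′ <_) (sym (length-∷ʳ T x)) (s≤s (length-mono-≤ S′⊆T))
      open SemitoneSubsequence (semitoneSubsequence ρ S′ (smaller S′<S))
        renaming (xs⊆S to xs⊆S′)

  enumerate : U ⤖ Fin n → ∃ λ us → Unique us × length us ≡ n
  enumerate π = map from (allFin n) , Unique.map⁺ injective (Unique.allFin⁺ n) ,
                trans (length-map from (allFin n)) (length-tabulate (λ i → i))
    where open Bijection (⤖-sym π) renaming (to to from)

mainTheorem10 : (U : Set) (n k : ℕ) → 1 ≤ n → 1 ≤ k →
    (π : Fin k → U ⤖ Fin n) →
    ∃ λ (xs : List U) → Unique xs × (∀ i → SemitoneWrt (π i) xs) ×
    n < 2 ^ (length xs * suc k)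
mainTheorem10 U n k _ 1≤k π with enumerate (π (Fin.fromℕ< 1≤k))
... | us , us-unique , us-length =
  xs , unique-⊆ xs⊆S us-unique , semitone ,
  subst (λ m → m < 2 ^ (length xs * suc k)) us-length long
  where
    open SemitoneSubsequence
      (semitoneSubsequence (λ i → Bijection.to (π i)) us (<-wellFounded (length us)))
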